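{- Let $T,T'$ be trees of the same size such that the covering relation $\triangleright_T$ (as a set of pairs) is properly included in $\triangleright_{T'}$. Then $\langle T\rangle<^{\mathrm{Lex}}\langle T'\rangle$.
   Context: Trees: finite binary rooted trees; $\bullet$ is the one-leaf tree and $T_0\wedge T_1$ the tree with left subtree $T_0$ and right subtree $T_1$; size = number of internal nodes. Addresses are finite words over $\{0,1\}$ describing the path from the root (0 = left, 1 = right). Label the leaves of a size-$n$ tree $T$ by $0,1,\dots,n$ from left to right and let $\mathrm{add}_T(i)$ be the address of leaf $i$. For $j>i$, $j\triangleright_T i$ ($j$ covers $i$ in $T$) means that there is an address $\gamma$ such that $\mathrm{add}_T(j)=\gamma1^p$ for some $p\ge1$ and $\mathrm{add}_T(i)$ begins with $\gamma0$. The Polish encoding $\langle T\rangle$ is the word over $\{\bullet,\circ\}$ with $\langle\bullet\rangle=\bullet$ and $\langle T_0\wedge T_1\rangle=\langle T_0\rangle\langle T_1\rangle\circ$; $<^{\mathrm{Lex}}$ is the lexicographic order induced by $\bullet<\circ$. -}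

module Defs where

open import Data.Nat using (ℕ; zero; suc; _+_; _<_; _≤_)
open import Data.List using (List; []; _∷_; _++_; map; replicate; lookup; length)
open import Data.Fin using (Fin; fromℕ<)
open import Data.Product using (Σ; ∃; _×_; _,_)
open import Data.Empty using (⊥)
open import Data.Unit using (⊤)
open import Relation.Binary.PropositionalEquality using (_≡_; refl)
open import Relation.Nullary using (¬_)
open import Data.List.Relation.Binary.Lex.Core using (Lex-<)

data Tree : Set where
  ● : Tree
  _∧_ : Tree → Tree → Tree

size : Tree → ℕ
size ● = 0
size (t ∧ u) = suc (size t + size u)

-- directions: 0 = left, 1 = right
data Dir : Set where
  d0 d1 : Dir

Address : Set
Address = List Dir

-- addresses of leaves, listed from left to right (leaf 0, leaf 1, ..., leaf n)
leafAddrs : Tree → List Address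
leafAddrs ● = [] ∷ []
leafAddrs (t ∧ u) = map (d0 ∷_) (leafAddrs t) ++ map (d1 ∷_) (leafAddrs u)

-- add_T(i) = a, for the leaf labelled i (leaf i exists iff i ≤ size T)
AddIs : Tree → ℕ → Address → Set
AddIs T i a = Σ (i < length (leafAddrs T)) λ lt → lookup (leafAddrs T) (fromℕ< lt) ≡ a

Covers : Tree → ℕ → ℕ → Set
Covers T j i =
  i < j ×
  Σ Address λ γ → Σ ℕ λ p → Σ Address λ δ →
    (1 ≤ p) × AddIs T j (γ ++ replicate p d1) × AddIs T i (γ ++ (d0 ∷ δ))

data Sym : Set where
  • ∘ : Sym

polish : Tree → List Sym
polish ● = • ∷ []
polish (t ∧ u) = polish t ++ polish u ++ (∘ ∷ [])

data _<Sym_ : Sym → Sym → Set where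
  •<∘ : • <Sym ∘

-- lexicographic (strict) order induced by • < ∘ (a proper prefix is smaller)
_<Lex_ : List Sym → List Sym → Set
_<Lex_ = Lex-< _≡_ _<Sym_

ProperlyIncluded : Tree → Tree → Set
ProperlyIncluded T T' =
  (∀ j i → Covers T j i → Covers T' j i) ×
  (Σ ℕ λ j → Σ ℕ λ i → Covers T' j i × ¬ Covers T j i)

module Submission where

-- For a tree T of size n and a leaf j ≤ n let span_T(j) be the size of the
-- largest subtree of T whose rightmost leaf is j (so span_T(n) = n).  Then the
-- covering relation is an interval relation:
--     j ▷_T i   ⇔   i < j ≤ i + span_T(j),
-- leaf j covers exactly the span_T(j) leaves immediately to its left.  Hence
-- ▷_T ⊆ ▷_T' gives span_T ≤ span_T' pointwise, and equal span sequences give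
-- ▷_T = ▷_T'.  Write ⟨T⟩ = • ∘^c₀ • ∘^c₁ ⋯ • ∘^cₙ.  Evaluating ⟨T⟩ with a stack
-- (• pushes 0, ∘ merges the two top entries) leaves span_T(j) on top after the
-- j-th block.  At the first block where the counts of T and T' differ the two
-- stacks agree, and more merges give a strictly larger top; so pointwise
-- span_T ≤ span_T' makes the count of T the smaller one there, which is
-- ⟨T⟩ <Lex ⟨T'⟩.  If no block differs, the spans and hence the covering
-- relations agree, contradicting properness.

open import Defs
open import Data.Nat using (ℕ; zero; suc; _+_; _<_; _≤_; z≤n; s≤s; _≤?_)
open import Data.Nat.Properties
open import Data.List using (List; []; _∷_; _++_; map; replicate; lookup; length)
open import Data.List.Properties using (length-map; length-++; ++-assoc; ++-identityʳ)
open import Data.List.Relation.Binary.Lex.Core using (Lex-<; halt; this; next)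
open import Data.Fin using (fromℕ<)
open import Data.Product using (Σ; ∃; ∃₂; _×_; _,_; proj₁; proj₂)
open import Data.Sum using (_⊎_; inj₁; inj₂)
open import Data.Empty using (⊥-elim)
open import Relation.Binary.Definitions using (tri<; tri≈; tri>)
open import Relation.Binary.PropositionalEquality
open import Relation.Nullary using (¬_; yes; no)

At : {A : Set} → List A → ℕ → A → Set
At xs i x = Σ (i < length xs) λ lt → lookup xs (fromℕ< lt) ≡ x

module _ {A : Set} where

  at-map : {B : Set} (f : A → B) (xs : List A) {i : ℕ} {x : A} →
           At xs i x → At (map f xs) i (f x)
  at-map f (y ∷ xs) {zero}  (s≤s _ , refl) = s≤s z≤n , refl
  at-map f (y ∷ xs) {suc i} (s≤s lt , eq) with at-map f xs (lt , eq)
  ... | lt' , eq' = s≤s lt' , eq'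

  at-map⁻ : {B : Set} (f : A → B) (xs : List A) {i : ℕ} {y : B} →
            At (map f xs) i y → ∃ λ x → At xs i x × f x ≡ y
  at-map⁻ f (x ∷ xs) {zero}  (s≤s _ , eq) = x , (s≤s z≤n , refl) , eq
  at-map⁻ f (x ∷ xs) {suc i} (s≤s lt , eq) with at-map⁻ f xs (lt , eq)
  ... | z , (lt' , eq') , fz≡y = z , (s≤s lt' , eq') , fz≡y

  at-++ˡ : (xs ys : List A) {i : ℕ} {x : A} → At xs i x → At (xs ++ ys) i x
  at-++ˡ (y ∷ xs) ys {zero}  (s≤s _ , eq) = s≤s z≤n , eq
  at-++ˡ (y ∷ xs) ys {suc i} (s≤s lt , eq) with at-++ˡ xs ys (lt , eq)
  ... | lt' , eq' = s≤s lt' , eq'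

  at-++ʳ : (xs ys : List A) {i : ℕ} {x : A} → At ys i x → At (xs ++ ys) (length xs + i) x
  at-++ʳ []       ys p = p
  at-++ʳ (y ∷ xs) ys p with at-++ʳ xs ys p
  ... | lt' , eq' = s≤s lt' , eq'

  at-++⁻ : (xs ys : List A) {i : ℕ} {x : A} → At (xs ++ ys) i x →
           At xs i x ⊎ ∃ λ k → i ≡ length xs + k × At ys k x
  at-++⁻ []       ys p = inj₂ (_ , refl , p)
  at-++⁻ (y ∷ xs) ys {zero}  (s≤s _ , eq) = inj₁ (s≤s z≤n , eq)
  at-++⁻ (y ∷ xs) ys {suc i} (s≤s lt , eq) with at-++⁻ xs ys (lt , eq)
  ... | inj₁ (lt' , eq')    = inj₁ (s≤s lt' , eq')
  ... | inj₂ (k , i≡ , p)  = inj₂ (k , cong suc i≡ , p)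

-- Entry k of a list of numbers, 0 beyond its end.
infixl 9 _!_
_!_ : List ℕ → ℕ → ℕ
[]       ! _     = 0
(x ∷ xs) ! zero  = x
(x ∷ xs) ! suc k = xs ! k

!-++ˡ : ∀ xs ys {k} → k < length xs → (xs ++ ys) ! k ≡ xs ! k
!-++ˡ (x ∷ xs) ys {zero}  _        = refl
!-++ˡ (x ∷ xs) ys {suc k} (s≤s lt) = !-++ˡ xs ys lt

!-++ʳ : ∀ xs ys k → (xs ++ ys) ! (length xs + k) ≡ ys ! k
!-++ʳ []       ys k = refl
!-++ʳ (x ∷ xs) ys k = !-++ʳ xs ys k

!-beyond : ∀ xs {k} → length xs ≤ k → xs ! k ≡ 0
!-beyond []       _         = refl
!-beyond (x ∷ xs) (s≤s len≤k) = !-beyond xs len≤k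

setLast : ℕ → List ℕ → List ℕ
setLast v []           = []
setLast v (x ∷ [])     = v ∷ []
setLast v (x ∷ y ∷ xs) = x ∷ setLast v (y ∷ xs)

length-setLast : ∀ v xs → length (setLast v xs) ≡ length xs
length-setLast v []           = refl
length-setLast v (x ∷ [])     = refl
length-setLast v (x ∷ y ∷ xs) = cong suc (length-setLast v (y ∷ xs))

!-setLast-init : ∀ v xs {k} → suc k < length xs → setLast v xs ! k ≡ xs ! k
!-setLast-init v (x ∷ [])     {zero}  (s≤s ())
!-setLast-init v (x ∷ y ∷ xs) {zero}  _        = refl
!-setLast-init v (x ∷ y ∷ xs) {suc k} (s≤s lt) = !-setLast-init v (y ∷ xs) lt

!-setLast-last : ∀ v xs {k} → suc k ≡ length xs → setLast v xs ! k ≡ v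
!-setLast-last v (x ∷ [])     {zero}  _  = refl
!-setLast-last v (x ∷ y ∷ xs) {suc k} eq = !-setLast-last v (y ∷ xs) (suc-injective eq)

data Leaf : Tree → ℕ → Address → Set where
  root  : Leaf ● 0 []
  left  : ∀ {A B i α} → Leaf A i α → Leaf (A ∧ B) i (d0 ∷ α)
  right : ∀ {A B i α} → Leaf B i α → Leaf (A ∧ B) (suc (size A + i)) (d1 ∷ α)

length-leafAddrs : ∀ T → length (leafAddrs T) ≡ suc (size T)
length-leafAddrs ● = refl
length-leafAddrs (A ∧ B) = begin
  length (map (d0 ∷_) (leafAddrs A) ++ map (d1 ∷_) (leafAddrs B))
    ≡⟨ length-++ (map (d0 ∷_) (leafAddrs A)) ⟩
  length (map (d0 ∷_) (leafAddrs A)) + length (map (d1 ∷_) (leafAddrs B))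
    ≡⟨ cong₂ _+_ (length-leftAddrs A) (trans (length-map (d1 ∷_) (leafAddrs B)) (length-leafAddrs B)) ⟩
  suc (size A) + suc (size B)
    ≡⟨ cong suc (+-suc (size A) (size B)) ⟩
  suc (size (A ∧ B)) ∎
  where
  open ≡-Reasoning
  length-leftAddrs : ∀ A → length (map (d0 ∷_) (leafAddrs A)) ≡ suc (size A)
  length-leftAddrs A = trans (length-map (d0 ∷_) (leafAddrs A)) (length-leafAddrs A)

leaf⇒addIs : ∀ {T i α} → Leaf T i α → AddIs T i α
leaf⇒addIs root = s≤s z≤n , refl
leaf⇒addIs {A ∧ B} (left l) =
  at-++ˡ (map (d0 ∷_) (leafAddrs A)) _ (at-map (d0 ∷_) (leafAddrs A) (leaf⇒addIs l))
leaf⇒addIs {A ∧ B} (right {i = i} {α} l) =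
  subst (λ k → AddIs (A ∧ B) (k + i) (d1 ∷ α))
        (trans (length-map (d0 ∷_) (leafAddrs A)) (length-leafAddrs A))
        (at-++ʳ (map (d0 ∷_) (leafAddrs A)) _ (at-map (d1 ∷_) (leafAddrs B) (leaf⇒addIs l)))

addIs⇒leaf : ∀ T {i α} → AddIs T i α → Leaf T i α
addIs⇒leaf ● {zero}  (s≤s z≤n , refl) = root
addIs⇒leaf ● {suc i} (s≤s () , _)
addIs⇒leaf (A ∧ B) p with at-++⁻ (map (d0 ∷_) (leafAddrs A)) _ p
... | inj₁ q with at-map⁻ (d0 ∷_) (leafAddrs A) q
...   | _ , r , refl = left (addIs⇒leaf A r)
addIs⇒leaf (A ∧ B) p | inj₂ (k , refl , q) with at-map⁻ (d1 ∷_) (leafAddrs B) q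
... | _ , r , refl
  rewrite length-map (d0 ∷_) (leafAddrs A) | length-leafAddrs A = right (addIs⇒leaf B r)

leaf-ones : ∀ {T j} p → Leaf T j (replicate p d1) → j ≡ size T
leaf-ones zero root = refl
leaf-ones {A ∧ B} (suc p) (right l) = cong (λ k → suc (size A + k)) (leaf-ones p l)

leaf-rightmost : ∀ T → ∃ λ q → Leaf T (size T) (replicate q d1)
leaf-rightmost ● = 0 , root
leaf-rightmost (A ∧ B) with leaf-rightmost B
... | q , l = suc q , right l

leaf-exists : ∀ T i → i ≤ size T → ∃ (Leaf T i)
leaf-exists ● zero _ = [] , root
leaf-exists (A ∧ B) i i≤n with i ≤? size A
... | yes i≤a with leaf-exists A i i≤a
...   | α , l = d0 ∷ α , left l
leaf-exists (A ∧ B) i i≤n | no i≰a with m≤n⇒∃[o]m+o≡n (≰⇒> i≰a)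
... | k , refl with leaf-exists B k (+-cancelˡ-≤ (suc (size A)) k (size B) i≤n)
...   | α , l = d1 ∷ α , right l

Cov : Tree → ℕ → ℕ → Set
Cov T j i =
  i < j ×
  Σ Address λ γ → Σ ℕ λ p → Σ Address λ δ →
    (1 ≤ p) × Leaf T j (γ ++ replicate p d1) × Leaf T i (γ ++ (d0 ∷ δ))

covers⇒cov : ∀ T {j i} → Covers T j i → Cov T j i
covers⇒cov T (i<j , γ , p , δ , 1≤p , aj , ai) = i<j , γ , p , δ , 1≤p , addIs⇒leaf T aj , addIs⇒leaf T ai

cov⇒covers : ∀ T {j i} → Cov T j i → Covers T j i
cov⇒covers T (i<j , γ , p , δ , 1≤p , lj , li) = i<j , γ , p , δ , 1≤p , leaf⇒addIs lj , leaf⇒addIs li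

cov-left : ∀ {A B j i} → Cov A j i → Cov (A ∧ B) j i
cov-left (i<j , γ , p , δ , 1≤p , lj , li) = i<j , d0 ∷ γ , p , δ , 1≤p , left lj , left li

cov-right : ∀ {A B j i} → Cov B j i → Cov (A ∧ B) (suc (size A + j)) (suc (size A + i))
cov-right {A} (i<j , γ , p , δ , 1≤p , lj , li) =
  s≤s (+-monoʳ-< (size A) i<j) , d1 ∷ γ , p , δ , 1≤p , right lj , right li

cov-root : ∀ A B i → i ≤ size A → Cov (A ∧ B) (size (A ∧ B)) i
cov-root A B i i≤a with leaf-rightmost B | leaf-exists A i i≤a
... | q , lj | δ , li = s≤s (≤-trans i≤a (m≤m+n (size A) (size B))) , [] , suc q , δ , s≤s z≤n , right lj , left li

-- The span sequence and the interval characterisation of ▷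

-- spanSeq T lists span_T(0), …, span_T(n): in A ∧ B the leaves keep their spans
-- inside A and B, except the rightmost leaf, whose span becomes the whole tree.
spanSeq : Tree → List ℕ
spanSeq ●       = 0 ∷ []
spanSeq (A ∧ B) = spanSeq A ++ setLast (size (A ∧ B)) (spanSeq B)

-- span T j = span_T(j), and 0 for j > size T.
span : Tree → ℕ → ℕ
span T j = spanSeq T ! j

length-spanSeq : ∀ T → length (spanSeq T) ≡ suc (size T)
length-spanSeq ● = refl
length-spanSeq (A ∧ B) = begin
  length (spanSeq A ++ setLast (size (A ∧ B)) (spanSeq B))
    ≡⟨ length-++ (spanSeq A) ⟩
  length (spanSeq A) + length (setLast (size (A ∧ B)) (spanSeq B))
    ≡⟨ cong₂ _+_ (length-spanSeq A) (trans (length-setLast _ (spanSeq B)) (length-spanSeq B)) ⟩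
  suc (size A) + suc (size B)
    ≡⟨ cong suc (+-suc (size A) (size B)) ⟩
  suc (size (A ∧ B)) ∎
  where open ≡-Reasoning

data Position (A B : Tree) : ℕ → Set where
  inLeft  : ∀ {j} → j ≤ size A → Position A B j
  inRight : ∀ {m} → m < size B → Position A B (suc (size A + m))
  atEnd   : Position A B (size (A ∧ B))
  beyond  : ∀ {j} → size (A ∧ B) < j → Position A B j

position : ∀ A B j → Position A B j
position A B j with j ≤? size A
... | yes j≤a = inLeft j≤a
... | no j≰a with m≤n⇒∃[o]m+o≡n (≰⇒> j≰a)
...   | m , refl with <-cmp m (size B)
...     | tri< m<b _ _ = inRight m<b
...     | tri≈ _ refl _ = atEnd
...     | tri> _ _ m>b = beyond (s≤s (+-monoʳ-< (size A) m>b))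

span-● : ∀ j → span ● j ≡ 0
span-● zero    = refl
span-● (suc j) = refl

span-inLeft : ∀ A B {j} → j ≤ size A → span (A ∧ B) j ≡ span A j
span-inLeft A B j≤a = !-++ˡ (spanSeq A) _ (subst (_ <_) (sym (length-spanSeq A)) (s≤s j≤a))

span-inB : ∀ A B m → span (A ∧ B) (suc (size A + m)) ≡ setLast (size (A ∧ B)) (spanSeq B) ! m
span-inB A B m = trans (cong (λ k → spanSeq (A ∧ B) ! (k + m)) (sym (length-spanSeq A)))
                       (!-++ʳ (spanSeq A) _ m)

span-inRight : ∀ A B {m} → m < size B → span (A ∧ B) (suc (size A + m)) ≡ span B m
span-inRight A B {m} m<b =
  trans (span-inB A B m) (!-setLast-init _ (spanSeq B) (subst (suc m <_) (sym (length-spanSeq B)) (s≤s m<b)))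

span-end : ∀ T → span T (size T) ≡ size T
span-end ● = refl
span-end (A ∧ B) =
  trans (span-inB A B (size B)) (!-setLast-last _ (spanSeq B) (sym (length-spanSeq B)))

span-beyond : ∀ T {j} → size T < j → span T j ≡ 0
span-beyond T n<j = !-beyond (spanSeq T) (subst (_≤ _) (sym (length-spanSeq T)) n<j)

span-≤ : ∀ T j → span T j ≤ j
span-≤ ● j rewrite span-● j = z≤n
span-≤ (A ∧ B) j with position A B j
... | inLeft j≤a   rewrite span-inLeft A B j≤a = span-≤ A j
... | inRight {m} m<b rewrite span-inRight A B m<b = ≤-trans (span-≤ B m) (≤-trans (m≤n+m m (size A)) (n≤1+n _))
... | atEnd        rewrite span-end (A ∧ B) = ≤-refl
... | beyond n<j   rewrite span-beyond (A ∧ B) n<j = z≤n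

Interval : (ℕ → ℕ) → ℕ → ℕ → Set
Interval f j i = i < j × j ≤ i + f j

no-interval : ∀ f {j i} → f j ≡ 0 → ¬ Interval f j i
no-interval f {j} {i} fj≡0 (i<j , j≤i+fj) =
  <-irrefl refl (<-≤-trans i<j (≤-trans j≤i+fj (≤-reflexive (trans (cong (i +_) fj≡0) (+-identityʳ i)))))

interval-inside : ∀ T {j i} → Interval (span T) j i → j ≤ size T
interval-inside T {j} iv with j ≤? size T
... | yes j≤n = j≤n
... | no j≰n  = ⊥-elim (no-interval (span T) (span-beyond T (≰⇒> j≰n)) iv)

-- If the interval relation of f is contained in that of g, then f ≤ g wherever
-- f j ≤ j (take i = j − f j, the leftmost leaf in the interval of j).
interval-mono : ∀ f g → (∀ j i → Interval f j i → Interval g j i) → ∀ j → f j ≤ j → f j ≤ g j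
interval-mono f g incl j fj≤j with f j in fj≡ | m≤n⇒∃[o]m+o≡n fj≤j
... | zero  | _ = z≤n
... | suc s | o , s+o≡j = +-cancelʳ-≤ o (suc s) (g j) (begin
  suc s + o ≡⟨ s+o≡j ⟩
  j         ≤⟨ proj₂ (incl j o (o<j , j≤o+fj)) ⟩
  o + g j   ≡⟨ +-comm o (g j) ⟩
  g j + o   ∎)
  where
  open ≤-Reasoning
  o<j : o < j
  o<j = subst (o <_) s+o≡j (s≤s (m≤n+m o s))
  j≤o+fj : j ≤ o + f j
  j≤o+fj = ≤-reflexive (trans (sym s+o≡j) (trans (+-comm (suc s) o) (cong (o +_) (sym fj≡))))

interval-end : ∀ T i → i < size T → Interval (span T) (size T) i
interval-end T i i<n = i<n , subst (λ s → size T ≤ i + s) (sym (span-end T)) (m≤n+m (size T) i)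

interval-left : ∀ A B {j i} → Interval (span A) j i → Interval (span (A ∧ B)) j i
interval-left A B {j} {i} iv@(i<j , j≤) =
  i<j , subst (λ s → j ≤ i + s) (sym (span-inLeft A B (interval-inside A iv))) j≤

interval-right : ∀ A B {j i} → Interval (span B) j i →
                 Interval (span (A ∧ B)) (suc (size A + j)) (suc (size A + i))
interval-right A B {j} {i} iv@(i<j , j≤) with m≤n⇒m<n∨m≡n (interval-inside B iv)
... | inj₁ j<b = s≤s (+-monoʳ-< (size A) i<j) ,
  subst (λ s → suc (size A + j) ≤ suc (size A + i) + s) (sym (span-inRight A B j<b))
        (s≤s (subst (size A + j ≤_) (sym (+-assoc (size A) i (span B j))) (+-monoʳ-≤ (size A) j≤)))
... | inj₂ refl = interval-end (A ∧ B) _ (s≤s (+-monoʳ-< (size A) i<j))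

cov⇒interval : ∀ T {j i} → Cov T j i → Interval (span T) j i
cov⇒interval ● (_ , [] , suc p , _ , _ , () , _)
cov⇒interval ● (_ , _ ∷ _ , _ , _ , _ , () , _)
cov⇒interval (A ∧ B) {j} {i} (i<j , [] , p , _ , _ , lj , _) with leaf-ones p lj
... | refl = interval-end (A ∧ B) i i<j
cov⇒interval (A ∧ B) (i<j , d0 ∷ γ , p , δ , 1≤p , left lj , left li) =
  interval-left A B (cov⇒interval A (i<j , γ , p , δ , 1≤p , lj , li))
cov⇒interval (A ∧ B) (i<j , d1 ∷ γ , p , δ , 1≤p , right {i = j} lj , right {i = i} li) =
  interval-right A B (cov⇒interval B (+-cancelˡ-< (size A) i j (≤-pred i<j) , γ , p , δ , 1≤p , lj , li))

unshift : ∀ a {m i s} → i < suc (a + m) → suc (a + m) ≤ i + s → s ≤ m →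
          ∃ λ i' → i ≡ suc (a + i') × Interval (λ _ → s) m i'
unshift a {m} {i} {s} i<j j≤i+s s≤m
  with m≤n⇒∃[o]m+o≡n (+-cancelʳ-≤ m (suc a) i (≤-trans j≤i+s (+-monoʳ-≤ i s≤m)))
... | i' , refl = i' , refl , +-cancelˡ-< a i' m (≤-pred i<j) ,
  +-cancelˡ-≤ a m (i' + s) (subst (a + m ≤_) (+-assoc a i' s) (≤-pred j≤i+s))

interval⇒cov : ∀ T j i → Interval (span T) j i → Cov T j i
interval⇒cov ● j i iv = ⊥-elim (no-interval (span ●) (span-● j) iv)
interval⇒cov (A ∧ B) j i iv with position A B j
... | inLeft j≤a =
  cov-left (interval⇒cov A j i (proj₁ iv , subst (λ s → j ≤ i + s) (span-inLeft A B j≤a) (proj₂ iv)))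
... | inRight {m} m<b
  with unshift (size A) (proj₁ iv) (subst (λ s → _ ≤ i + s) (span-inRight A B m<b) (proj₂ iv)) (span-≤ B m)
...   | i' , refl , iv' = cov-right (interval⇒cov B m i' iv')
interval⇒cov (A ∧ B) j i iv | atEnd with i ≤? size A
... | yes i≤a = cov-root A B i i≤a
... | no i≰a with m≤n⇒∃[o]m+o≡n (≰⇒> i≰a)
...   | i' , refl = cov-right (interval⇒cov B (size B) i'
          (interval-end B i' (+-cancelˡ-< (size A) i' (size B) (≤-pred (proj₁ iv)))))
interval⇒cov (A ∧ B) j i iv | beyond n<j = ⊥-elim (no-interval (span (A ∧ B)) (span-beyond (A ∧ B) n<j) iv)

span-mono : ∀ T T' → (∀ j i → Covers T j i → Covers T' j i) → ∀ k → span T k ≤ span T' k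
span-mono T T' incl k = interval-mono (span T) (span T') interval-incl k (span-≤ T k)
  where
  interval-incl : ∀ j i → Interval (span T) j i → Interval (span T') j i
  interval-incl j i iv = cov⇒interval T' (covers⇒cov T' (incl j i (cov⇒covers T (interval⇒cov T j i iv))))

-- The Polish word as a list of ∘-blocks

encode : List ℕ → List Sym
encode []       = []
encode (c ∷ cs) = • ∷ (replicate c ∘ ++ encode cs)

encode-++ : ∀ xs ys → encode (xs ++ ys) ≡ encode xs ++ encode ys
encode-++ []       ys = refl
encode-++ (c ∷ xs) ys = cong (• ∷_) (trans (cong (replicate c ∘ ++_) (encode-++ xs ys))
                                          (sym (++-assoc (replicate c ∘) (encode xs) (encode ys))))

incLast : List ℕ → List ℕ
incLast []           = []
incLast (c ∷ [])     = suc c ∷ []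
incLast (c ∷ d ∷ cs) = c ∷ incLast (d ∷ cs)

length-incLast : ∀ cs → length (incLast cs) ≡ length cs
length-incLast []           = refl
length-incLast (c ∷ [])     = refl
length-incLast (c ∷ d ∷ cs) = cong suc (length-incLast (d ∷ cs))

encode-incLast : ∀ c cs → encode (incLast (c ∷ cs)) ≡ encode (c ∷ cs) ++ (∘ ∷ [])
encode-incLast c [] = cong (• ∷_) (begin
  ∘ ∷ replicate c ∘ ++ []         ≡⟨ ++-identityʳ _ ⟩
  ∘ ∷ replicate c ∘               ≡⟨ sym (∘-snoc c) ⟩
  replicate c ∘ ++ (∘ ∷ [])       ≡⟨ cong (_++ (∘ ∷ [])) (sym (++-identityʳ (replicate c ∘))) ⟩
  (replicate c ∘ ++ []) ++ (∘ ∷ []) ∎)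
  where
  open ≡-Reasoning
  ∘-snoc : ∀ c → replicate c ∘ ++ (∘ ∷ []) ≡ ∘ ∷ replicate c ∘
  ∘-snoc zero    = refl
  ∘-snoc (suc c) = cong (∘ ∷_) (∘-snoc c)
encode-incLast c (d ∷ cs) = cong (• ∷_) (trans (cong (replicate c ∘ ++_) (encode-incLast d cs))
                                              (sym (++-assoc (replicate c ∘) (encode (d ∷ cs)) (∘ ∷ []))))

blocks : Tree → List ℕ
blocks ●       = 0 ∷ []
blocks (A ∧ B) = blocks A ++ incLast (blocks B)

blocks-nonempty : ∀ T → ∃₂ λ c cs → blocks T ≡ c ∷ cs
blocks-nonempty ● = 0 , [] , refl
blocks-nonempty (A ∧ B) with blocks-nonempty A
... | c , cs , eq rewrite eq = c , _ , refl

length-blocks : ∀ T → length (blocks T) ≡ suc (size T)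
length-blocks ● = refl
length-blocks (A ∧ B) =
  trans (length-++ (blocks A))
        (trans (cong₂ _+_ (length-blocks A) (trans (length-incLast (blocks B)) (length-blocks B)))
               (cong suc (+-suc (size A) (size B))))

polish-blocks : ∀ T → polish T ≡ encode (blocks T)
polish-blocks ● = refl
polish-blocks (A ∧ B) with blocks-nonempty B
... | c , cs , eq = begin
  polish A ++ polish B ++ (∘ ∷ [])
    ≡⟨ cong₂ (λ u v → u ++ v ++ (∘ ∷ [])) (polish-blocks A) (trans (polish-blocks B) (cong encode eq)) ⟩
  encode (blocks A) ++ encode (c ∷ cs) ++ (∘ ∷ [])
    ≡⟨ cong (encode (blocks A) ++_) (sym (encode-incLast c cs)) ⟩
  encode (blocks A) ++ encode (incLast (c ∷ cs))
    ≡⟨ sym (encode-++ (blocks A) _) ⟩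
  encode (blocks A ++ incLast (c ∷ cs))
    ≡⟨ cong (λ l → encode (blocks A ++ incLast l)) (sym eq) ⟩
  encode (blocks (A ∧ B)) ∎
  where open ≡-Reasoning

shorter-block-lex : ∀ x y xs ys → x < y → (replicate x ∘ ++ encode xs) <Lex (replicate y ∘ ++ encode ys)
shorter-block-lex zero    (suc y) []      ys _        = halt
shorter-block-lex zero    (suc y) (_ ∷ _) ys _        = this •<∘
shorter-block-lex (suc x) (suc y) xs      ys (s≤s lt) = next refl (shorter-block-lex x y xs ys lt)

common-prefix-lex : ∀ (ps : List Sym) {u v} → u <Lex v → (ps ++ u) <Lex (ps ++ v)
common-prefix-lex []       lt = lt
common-prefix-lex (p ∷ ps) lt = next refl (common-prefix-lex ps lt)

encode-lex : ∀ {xs ys} → Lex-< _≡_ _<_ xs ys → encode xs <Lex encode ys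
encode-lex halt                             = halt
encode-lex (this {x} {xs} {y} {ys} x<y)     = next refl (shorter-block-lex x y xs ys x<y)
encode-lex (next {x} refl lt)               = next refl (common-prefix-lex (replicate x ∘) (encode-lex lt))

-- Stack evaluation of the Polish word

-- One ∘: merge the two top subtrees (sizes x, y) into one of size y + x + 1.
merge : List ℕ → List ℕ
merge []           = 1 ∷ []
merge (x ∷ [])     = suc x ∷ []
merge (x ∷ y ∷ st) = suc (y + x) ∷ st

merge^ : ℕ → List ℕ → List ℕ
merge^ zero    st = st
merge^ (suc k) st = merge (merge^ k st)

top : List ℕ → ℕ
top []      = 0
top (x ∷ _) = x

block : ℕ → List ℕ → List ℕ
block c st = merge^ c (0 ∷ st)

tops : List ℕ → List ℕ → List ℕ
tops []       st = []
tops (c ∷ cs) st = top (block c st) ∷ tops cs (block c st)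

stackAfter : List ℕ → List ℕ → List ℕ
stackAfter []       st = st
stackAfter (c ∷ cs) st = stackAfter cs (block c st)

tops-++ : ∀ xs ys st → tops (xs ++ ys) st ≡ tops xs st ++ tops ys (stackAfter xs st)
tops-++ []       ys st = refl
tops-++ (c ∷ xs) ys st = cong (_ ∷_) (tops-++ xs ys (block c st))

stackAfter-++ : ∀ xs ys st → stackAfter (xs ++ ys) st ≡ stackAfter ys (stackAfter xs st)
stackAfter-++ []       ys st = refl
stackAfter-++ (c ∷ xs) ys st = stackAfter-++ xs ys (block c st)

stackAfter-incLast : ∀ c cs st → stackAfter (incLast (c ∷ cs)) st ≡ merge (stackAfter (c ∷ cs) st)
stackAfter-incLast c []       st = refl
stackAfter-incLast c (d ∷ cs) st = stackAfter-incLast d cs (block c st)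

tops-incLast : ∀ c cs st →
  tops (incLast (c ∷ cs)) st ≡ setLast (top (merge (stackAfter (c ∷ cs) st))) (tops (c ∷ cs) st)
tops-incLast c []       st = refl
tops-incLast c (d ∷ cs) st = cong (_ ∷_) (tops-incLast d cs (block c st))

evaluate : ∀ T st → stackAfter (blocks T) st ≡ size T ∷ st × tops (blocks T) st ≡ spanSeq T
evaluate ● st = refl , refl
evaluate (A ∧ B) st with blocks-nonempty B | evaluate A st | evaluate B (size A ∷ st)
... | c , cs , eq | stackA , topsA | stackB , topsB = stack , tops≡
  where
  open ≡-Reasoning
  stackB' : stackAfter (c ∷ cs) (size A ∷ st) ≡ size B ∷ size A ∷ st
  stackB' = trans (cong (λ l → stackAfter l (size A ∷ st)) (sym eq)) stackB
  topsB' : tops (c ∷ cs) (size A ∷ st) ≡ spanSeq B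
  topsB' = trans (cong (λ l → tops l (size A ∷ st)) (sym eq)) topsB
  stack : stackAfter (blocks (A ∧ B)) st ≡ size (A ∧ B) ∷ st
  stack = begin
    stackAfter (blocks A ++ incLast (blocks B)) st      ≡⟨ stackAfter-++ (blocks A) _ st ⟩
    stackAfter (incLast (blocks B)) (stackAfter (blocks A) st)
      ≡⟨ cong₂ (λ l s → stackAfter (incLast l) s) eq stackA ⟩
    stackAfter (incLast (c ∷ cs)) (size A ∷ st)        ≡⟨ stackAfter-incLast c cs _ ⟩
    merge (stackAfter (c ∷ cs) (size A ∷ st))          ≡⟨ cong merge stackB' ⟩
    size (A ∧ B) ∷ st                                  ∎
  tops≡ : tops (blocks (A ∧ B)) st ≡ spanSeq (A ∧ B)
  tops≡ = begin
    tops (blocks A ++ incLast (blocks B)) st            ≡⟨ tops-++ (blocks A) _ st ⟩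
    tops (blocks A) st ++ tops (incLast (blocks B)) (stackAfter (blocks A) st)
      ≡⟨ cong₂ (λ u v → u ++ tops (incLast v) (stackAfter (blocks A) st)) topsA eq ⟩
    spanSeq A ++ tops (incLast (c ∷ cs)) (stackAfter (blocks A) st)
      ≡⟨ cong (λ s → spanSeq A ++ tops (incLast (c ∷ cs)) s) stackA ⟩
    spanSeq A ++ tops (incLast (c ∷ cs)) (size A ∷ st)  ≡⟨ cong (spanSeq A ++_) (tops-incLast c cs _) ⟩
    spanSeq A ++ setLast (top (merge (stackAfter (c ∷ cs) (size A ∷ st)))) (tops (c ∷ cs) (size A ∷ st))
      ≡⟨ cong₂ (λ u v → spanSeq A ++ setLast (top (merge u)) v) stackB' topsB' ⟩
    spanSeq (A ∧ B)                                    ∎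

top-merge : ∀ st → top st < top (merge st)
top-merge []           = s≤s z≤n
top-merge (x ∷ [])     = ≤-refl
top-merge (x ∷ y ∷ st) = s≤s (m≤n+m x y)

top-merge^ : ∀ st {k k'} → k < k' → top (merge^ k st) < top (merge^ k' st)
top-merge^ st {k} {suc k'} k<1+k' with m≤n⇒m<n∨m≡n (≤-pred k<1+k')
... | inj₁ k<k' = <-trans (top-merge^ st k<k') (top-merge (merge^ k' st))
... | inj₂ refl = top-merge (merge^ k st)

first-difference : ∀ xs ys st → length xs ≡ length ys →
                   (∀ k → tops xs st ! k ≤ tops ys st ! k) → xs ≡ ys ⊎ Lex-< _≡_ _<_ xs ys
first-difference []       []       st _ _ = inj₁ refl
first-difference (x ∷ xs) (y ∷ ys) st len≡ tops≤ with <-cmp x y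
... | tri< x<y _ _ = inj₂ (this x<y)
... | tri> _ _ y<x = ⊥-elim (<-irrefl refl (<-≤-trans (top-merge^ (0 ∷ st) y<x) (tops≤ 0)))
... | tri≈ _ refl _ with first-difference xs ys (block x st) (suc-injective len≡) (λ k → tops≤ (suc k))
...   | inj₁ refl = inj₁ refl
...   | inj₂ lt   = inj₂ (next refl lt)

blocks-compare : ∀ T T' → size T ≡ size T' → (∀ j i → Covers T j i → Covers T' j i) →
                 blocks T ≡ blocks T' ⊎ Lex-< _≡_ _<_ (blocks T) (blocks T')
blocks-compare T T' size≡ incl = first-difference (blocks T) (blocks T') [] same-length tops≤
  where
  same-length : length (blocks T) ≡ length (blocks T')
  same-length = trans (length-blocks T) (trans (cong suc size≡) (sym (length-blocks T')))
  tops≤ : ∀ k → tops (blocks T) [] ! k ≤ tops (blocks T') [] ! k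
  tops≤ k rewrite proj₂ (evaluate T []) | proj₂ (evaluate T' []) = span-mono T T' incl k

same-blocks⇒same-covers : ∀ T T' → blocks T ≡ blocks T' → ∀ {j i} → Covers T' j i → Covers T j i
same-blocks⇒same-covers T T' blocks≡ {j} {i} covT' =
  cov⇒covers T (interval⇒cov T j i (subst (λ s → Interval (s !_) j i) (sym spanSeq≡)
                                           (cov⇒interval T' (covers⇒cov T' covT'))))
  where
  spanSeq≡ : spanSeq T ≡ spanSeq T'
  spanSeq≡ = trans (sym (proj₂ (evaluate T [])))
                   (trans (cong (λ l → tops l []) blocks≡) (proj₂ (evaluate T' [])))

lemma4p7 : (T T' : Tree) → size T ≡ size T' → ProperlyIncluded T T' → polish T <Lex polish T'
lemma4p7 T T' size≡ (incl , j , i , covT' , ¬covT) with blocks-compare T T' size≡ incl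
... | inj₂ lt      = subst₂ _<Lex_ (sym (polish-blocks T)) (sym (polish-blocks T')) (encode-lex lt)
... | inj₁ blocks≡ = ⊥-elim (¬covT (same-blocks⇒same-covers T T' blocks≡ covT'))
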